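{- Let $S$ be a completely simple semigroup with $n$ minimal left ideals. Then $\mathcal{I}n(S)$ has exactly $2^n-2$ vertices.
   Context: A semigroup $S$ is simple if it has no proper two-sided ideal, and completely simple if it is simple and contains a primitive idempotent (an idempotent $e$ minimal among idempotents under $e\le f\iff ef=fe=e$). A left ideal is a non-empty $I\subseteq S$ with $SI\subseteq I$; it is nontrivial if $I\neq S$ and minimal if it properly contains no left ideal. The inclusion ideal graph $\mathcal{I}n(S)$ is the simple undirected graph whose vertices are the nontrivial left ideals of $S$, with distinct $I,J$ adjacent iff $I\subset J$ or $J\subset I$. -}

module Defs where

open import Level using (Level; _⊔_) renaming (suc to lsuc)
open import Algebra.Bundles using (Semigroup)
open import Data.Product using (Σ; ∃; _×_; _,_; proj₁; proj₂)
open import Relation.Nullary using (¬_)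
open import Relation.Unary using (Pred; _⊆_; _∈_)
open import Relation.Binary using (Setoid; _Respects_)

module _ {c ℓ : Level} (S : Semigroup c ℓ) where
  open Semigroup S

  -- Subsets of S: predicates on the carrier (closure under ≈ is required
  -- where relevant, since the carrier is a setoid).
  Subset : Set (lsuc (c ⊔ ℓ))
  Subset = Pred Carrier (c ⊔ ℓ)

  NonEmpty : Subset → Set (c ⊔ ℓ)
  NonEmpty I = ∃ λ x → x ∈ I

  NotWhole : Subset → Set (c ⊔ ℓ)
  NotWhole I = ¬ (∀ x → x ∈ I)

  IsLeftIdeal : Subset → Set (c ⊔ ℓ)
  IsLeftIdeal I = (I Respects _≈_) × NonEmpty I
                × (∀ s {x} → x ∈ I → (s ∙ x) ∈ I)

  IsIdeal : Subset → Set (c ⊔ ℓ)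
  IsIdeal I = (I Respects _≈_) × NonEmpty I
            × (∀ s {x} → x ∈ I → (s ∙ x) ∈ I)
            × (∀ s {x} → x ∈ I → (x ∙ s) ∈ I)

  IsSimple : Set (lsuc (c ⊔ ℓ))
  IsSimple = ∀ (I : Subset) → IsIdeal I → ∀ x → x ∈ I

  IsIdempotent : Carrier → Set ℓ
  IsIdempotent e = e ∙ e ≈ e

  _≤E_ : Carrier → Carrier → Set ℓ
  e ≤E f = (e ∙ f ≈ e) × (f ∙ e ≈ e)

  IsPrimitiveIdempotent : Carrier → Set (c ⊔ ℓ)
  IsPrimitiveIdempotent e =
    IsIdempotent e × (∀ f → IsIdempotent f → f ≤E e → f ≈ e)

  IsCompletelySimple : Set (lsuc (c ⊔ ℓ))
  IsCompletelySimple = IsSimple × (∃ λ e → IsPrimitiveIdempotent e)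

  IsMinimalLeftIdeal : Subset → Set (lsuc (c ⊔ ℓ))
  IsMinimalLeftIdeal I =
    IsLeftIdeal I × (∀ (J : Subset) → IsLeftIdeal J → J ⊆ I → I ⊆ J)

  IsNontrivialLeftIdeal : Subset → Set (c ⊔ ℓ)
  IsNontrivialLeftIdeal I = IsLeftIdeal I × NotWhole I

  module _ {p : Level} (P : Subset → Set p) where
    SubsetsWith : Setoid (lsuc (c ⊔ ℓ) ⊔ p) (c ⊔ ℓ)
    SubsetsWith = record
      { Carrier = Σ Subset P
      ; _≈_ = λ I J → (proj₁ I ⊆ proj₁ J) × (proj₁ J ⊆ proj₁ I)
      ; isEquivalence = record
        { refl = (λ x → x) , (λ x → x)
        ; sym = λ (a , b) → b , a
        ; trans = λ (a , b) (a' , b') → (λ x → a' (a x)) , (λ x → b (b' x))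
        }
      }

  MinimalLeftIdeals : Setoid (lsuc (c ⊔ ℓ)) (c ⊔ ℓ)
  MinimalLeftIdeals = SubsetsWith IsMinimalLeftIdeal

  -- vertex set of the inclusion ideal graph In(S): nontrivial left ideals
  InVertices : Setoid (lsuc (c ⊔ ℓ)) (c ⊔ ℓ)
  InVertices = SubsetsWith IsNontrivialLeftIdeal

  InAdjacent : Setoid.Carrier InVertices → Setoid.Carrier InVertices → Set (c ⊔ ℓ)
  InAdjacent (I , _) (J , _) =
    ¬ ((I ⊆ J) × (J ⊆ I))
    × ((I ⊆ J × ¬ (J ⊆ I)) Data.Sum.⊎ (J ⊆ I × ¬ (I ⊆ J)))
    where import Data.Sum

-- The minimal left ideals of a completely simple semigroup S partition S: two of them that
-- meet coincide, and their union is a two-sided ideal (each L s is again a minimal left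
-- ideal), hence all of S by simplicity; at least one exists, namely S e for a primitive
-- idempotent e. Consequently every left ideal is the union of the minimal left ideals it
-- contains, so left ideals correspond to the nonempty subsets of the n minimal left ideals
-- and the nontrivial ones to the nonempty proper subsets, of which there are 2^n - 2.
-- Excluded middle is used to decide which minimal left ideals a given left ideal contains.
module Submission where

open import Level using (_⊔_)
open import Algebra.Bundles using (Semigroup)
open import Axiom.ExcludedMiddle using (ExcludedMiddle)
open import Data.Nat using (ℕ; _^_; _∸_)
open import Data.Fin using (Fin)
open import Function.Bundles using (Bijection)
open import Relation.Binary.PropositionalEquality using (setoid)
open import Defs

open import Data.Nat using (zero; suc)
open import Data.Fin using (zero; suc; punchIn; punchOut; funToFin; finToFun; combine; _≟_)
open import Data.Fin.Patterns using (0F; 1F)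
open import Data.Fin.Properties
  using (punchIn-injective; punchInᵢ≢i; punchIn-punchOut; funToFin-finToFin; finToFun-funToFin; ¬∀⟶∃¬)
open import Data.Product using (∃; ∃₂; _×_; _,_; proj₁; proj₂)
open import Function using (_∘_; Inverse; Injection)
open import Function.Properties.Inverse using (Inverse⇒Bijection; Inverse⇒Injection) renaming (sym to inverse-sym)
open import Function.Properties.Bijection using () renaming (trans to bijection-trans)
open import Relation.Binary using (Setoid)
open import Relation.Binary.PropositionalEquality as ≡ using (_≡_; _≢_; _≗_; _→-setoid_)
import Relation.Binary.Construct.On as On
open import Relation.Nullary using (¬_; Dec; yes; no; contradiction)
open import Relation.Unary using (_⊆_; _∈_)

≢⇒≡-Fin2 : ∀ {x v w : Fin 2} → v ≢ w → x ≢ v → x ≡ w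
≢⇒≡-Fin2 {0F} {0F}      _   x≢v = contradiction ≡.refl x≢v
≢⇒≡-Fin2 {0F} {1F} {0F} _   _   = ≡.refl
≢⇒≡-Fin2 {0F} {1F} {1F} v≢w _   = contradiction ≡.refl v≢w
≢⇒≡-Fin2 {1F} {0F} {0F} v≢w _   = contradiction ≡.refl v≢w
≢⇒≡-Fin2 {1F} {0F} {1F} _   _   = ≡.refl
≢⇒≡-Fin2 {1F} {1F}      _   x≢v = contradiction ≡.refl x≢v

≡1F⇔⇒≡ : ∀ {x y : Fin 2} → (x ≡ 1F → y ≡ 1F) → (y ≡ 1F → x ≡ 1F) → x ≡ y
≡1F⇔⇒≡ {0F} {0F} _   _   = ≡.refl
≡1F⇔⇒≡ {0F} {1F} _   y⇒x = contradiction (y⇒x ≡.refl) λ ()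
≡1F⇔⇒≡ {1F} {0F} x⇒y _   = contradiction (x⇒y ≡.refl) λ ()
≡1F⇔⇒≡ {1F} {1F} _   _   = ≡.refl

¬const⇒∃ : ∀ {n} (Q : Fin n → Fin 2) {v w : Fin 2} → v ≢ w → ¬ (∀ i → Q i ≡ v) → ∃ λ i → Q i ≡ w
¬const⇒∃ {n} Q {v} v≢w Q≉v =
  let (i , Qi≢v) = ¬∀⟶∃¬ n (λ i → Q i ≡ v) (λ i → Q i ≟ v) Q≉v in i , ≢⇒≡-Fin2 v≢w Qi≢v

indicator : ∀ {a} {A : Set a} → Dec A → Fin 2
indicator (yes _) = 1F
indicator (no _)  = 0F

indicator≡1F⇒ : ∀ {a} {A : Set a} (A? : Dec A) → indicator A? ≡ 1F → A
indicator≡1F⇒ (yes a) _ = a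

⇒indicator≡1F : ∀ {a} {A : Set a} (A? : Dec A) → A → indicator A? ≡ 1F
⇒indicator≡1F (yes _) _ = ≡.refl
⇒indicator≡1F (no ¬a) a = contradiction a ¬a

Without₂ : ∀ {a ℓ} (A : Setoid a ℓ) → Setoid.Carrier A → Setoid.Carrier A → Setoid (a ⊔ ℓ) ℓ
Without₂ A a b = On.setoid A (proj₁ {B = λ x → ¬ x ≈ a × ¬ x ≈ b})
  where open Setoid A

without₂ : ∀ {a₁ ℓ₁ a₂ ℓ₂} {A : Setoid a₁ ℓ₁} {B : Setoid a₂ ℓ₂} (F : Inverse A B) {a b : Setoid.Carrier A} →
           Inverse (Without₂ A a b) (Without₂ B (Inverse.to F a) (Inverse.to F b))
without₂ {A = A} {B} F = record
  { to        = λ (x , x≉a , x≉b) → to x , x≉a ∘ injective , x≉b ∘ injective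
  ; from      = λ (y , y≉a , y≉b) → from y , y≉a ∘ from≈⇒ , y≉b ∘ from≈⇒
  ; to-cong   = to-cong
  ; from-cong = from-cong
  ; inverse   = inverseˡ , inverseʳ
  }
  where
  module A = Setoid A
  module B = Setoid B
  open Inverse F
  open Injection (Inverse⇒Injection F) using (injective)
  from≈⇒ : ∀ {x y} → from y A.≈ x → y B.≈ to x
  from≈⇒ = B.sym ∘ inverseˡ ∘ A.sym

Fin-without₂ : ∀ {m} {a b : Fin m} → a ≢ b → Bijection (setoid (Fin (m ∸ 2))) (Without₂ (setoid (Fin m)) a b)
Fin-without₂ {suc zero} {zero} {zero} a≢b = contradiction ≡.refl a≢b
Fin-without₂ {suc (suc k)} {a} {b} a≢b = record
  { to        = λ x → embed x , punchInᵢ≢i a _ , embed≢b x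
  ; cong      = ≡.cong embed
  ; bijective = embed-injective
              , λ (y , y≢a , y≢b) → preimage y≢a y≢b , λ { ≡.refl → embed-preimage y≢a y≢b }
  }
  where
  b′ : Fin (suc k)
  b′ = punchOut a≢b
  embed : Fin k → Fin (suc (suc k))
  embed = punchIn a ∘ punchIn b′
  embed-injective : ∀ {x y} → embed x ≡ embed y → x ≡ y
  embed-injective = punchIn-injective b′ _ _ ∘ punchIn-injective a _ _
  embed≢b : ∀ x → embed x ≢ b
  embed≢b x eq = punchInᵢ≢i b′ x (punchIn-injective a _ _ (≡.trans eq (≡.sym (punchIn-punchOut a≢b))))
  module _ {y} (y≢a : y ≢ a) (y≢b : y ≢ b) where
    a≢y : a ≢ y
    a≢y = y≢a ∘ ≡.sym
    b′≢y′ : b′ ≢ punchOut a≢y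
    b′≢y′ eq = y≢b (≡.trans (≡.sym (punchIn-punchOut a≢y))
                     (≡.trans (≡.cong (punchIn a) (≡.sym eq)) (punchIn-punchOut a≢b)))
    preimage : Fin k
    preimage = punchOut b′≢y′
    embed-preimage : embed preimage ≡ y
    embed-preimage = ≡.trans (≡.cong (punchIn a) (punchIn-punchOut b′≢y′)) (punchIn-punchOut a≢y)

funToFin-cong : ∀ {m n} {f g : Fin m → Fin n} → f ≗ g → funToFin f ≡ funToFin g
funToFin-cong {zero}  f≗g = ≡.refl
funToFin-cong {suc m} f≗g = ≡.cong₂ combine (f≗g zero) (funToFin-cong (f≗g ∘ suc))

funToFin-inverse : ∀ {m n} → Inverse (Fin m →-setoid Fin n) (setoid (Fin (n ^ m)))
funToFin-inverse {m} = record
  { to        = funToFin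
  ; from      = finToFun
  ; to-cong   = funToFin-cong
  ; from-cong = λ { ≡.refl _ → ≡.refl }
  ; inverse   = (λ {k} f≗ → ≡.trans (funToFin-cong f≗) (funToFin-finToFin {m} k))
              , (λ { {f} ≡.refl i → finToFun-funToFin f i })
  }

module LeftIdeals {c ℓ} (S : Semigroup c ℓ) where
  open Semigroup S hiding (setoid)
  open import Algebra.Properties.Semigroup S using (x∙yz≈xy∙z)
  open import Relation.Binary.Reasoning.Setoid (Semigroup.setoid S)

  meet⇒⊆ : ∀ {A B z} → IsMinimalLeftIdeal S A → IsLeftIdeal S B → z ∈ A → z ∈ B → A ⊆ B
  meet⇒⊆ {A} {B} {z} ((A-resp , _ , A-left) , A-min) (B-resp , _ , B-left) z∈A z∈B x∈A =
    proj₂ (A-min A∩B A∩B-isLeftIdeal proj₁ x∈A)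
    where
    A∩B : Subset S
    A∩B x = x ∈ A × x ∈ B
    A∩B-isLeftIdeal : IsLeftIdeal S A∩B
    A∩B-isLeftIdeal = (λ x≈y (x∈A , x∈B) → A-resp x≈y x∈A , B-resp x≈y x∈B)
                    , (z , z∈A , z∈B)
                    , (λ s (x∈A , x∈B) → A-left s x∈A , B-left s x∈B)

  infixl 7 _·_
  _·_ : Subset S → Carrier → Subset S
  (A · s) w = ∃ λ u → u ∈ A × w ≈ u ∙ s

  ·-minimal : ∀ {A} → IsMinimalLeftIdeal S A → ∀ s → IsMinimalLeftIdeal S (A · s)
  ·-minimal {A} ((A-resp , (u₀ , u₀∈A) , A-left) , A-min) s =
    ( (λ w≈w′ (u , u∈A , w≈us) → u , u∈A , trans (sym w≈w′) w≈us)
    , (u₀ ∙ s , u₀ , u₀∈A , refl)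
    , (λ t (u , u∈A , w≈us) → t ∙ u , A-left t u∈A , trans (∙-congˡ w≈us) (x∙yz≈xy∙z t u s)))
    , minimal
    where
    minimal : ∀ J → IsLeftIdeal S J → J ⊆ A · s → A · s ⊆ J
    minimal J (J-resp , (w , w∈J) , J-left) J⊆As (u , u∈A , z≈us) =
      J-resp (sym z≈us) (proj₂ (A-min A′ A′-isLeftIdeal proj₁ u∈A))
      where
      A′ : Subset S
      A′ v = v ∈ A × v ∙ s ∈ J
      A′-isLeftIdeal : IsLeftIdeal S A′
      A′-isLeftIdeal =
          (λ v≈v′ (v∈A , vs∈J) → A-resp v≈v′ v∈A , J-resp (∙-congʳ v≈v′) vs∈J)
        , (let (v , v∈A , w≈vs) = J⊆As w∈J in v , v∈A , J-resp w≈vs w∈J)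
        , (λ t {v} (v∈A , vs∈J) → A-left t v∈A , J-resp (sym (assoc t v s)) (J-left t vs∈J))

  S·_ : Carrier → Subset S
  (S· e) w = ∃ λ s → w ≈ s ∙ e

  S·-isLeftIdeal : ∀ e → IsLeftIdeal S (S· e)
  S·-isLeftIdeal e = (λ w≈w′ (s , w≈se) → s , trans (sym w≈w′) w≈se)
                   , (e ∙ e , e , refl)
                   , (λ t (s , w≈se) → t ∙ s , trans (∙-congˡ w≈se) (x∙yz≈xy∙z t s e))

  ∈S·⇒∙-absorbs : ∀ {e w} → IsIdempotent S e → w ∈ S· e → w ∙ e ≈ w
  ∈S·⇒∙-absorbs {e} {w} ee≈e (s , w≈se) = begin
    w ∙ e        ≈⟨ ∙-congʳ w≈se ⟩
    (s ∙ e) ∙ e  ≈⟨ assoc s e e ⟩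
    s ∙ (e ∙ e)  ≈⟨ ∙-congˡ ee≈e ⟩
    s ∙ e        ≈⟨ sym w≈se ⟩
    w            ∎

  S·_·S : Carrier → Subset S
  (S· a ·S) w = ∃₂ λ x y → w ≈ (x ∙ a) ∙ y

  S·a·S-isIdeal : ∀ a → IsIdeal S (S· a ·S)
  S·a·S-isIdeal a =
      (λ w≈w′ (x , y , w≈xay) → x , y , trans (sym w≈w′) w≈xay)
    , ((a ∙ a) ∙ a , a , a , refl)
    , (λ t (x , y , w≈xay) → t ∙ x , y , (begin
        t ∙ _              ≈⟨ ∙-congˡ w≈xay ⟩
        t ∙ ((x ∙ a) ∙ y)  ≈⟨ x∙yz≈xy∙z t _ y ⟩
        (t ∙ (x ∙ a)) ∙ y  ≈⟨ ∙-congʳ (x∙yz≈xy∙z t x a) ⟩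
        ((t ∙ x) ∙ a) ∙ y  ∎))
    , (λ t (x , y , w≈xay) → x , y ∙ t , trans (∙-congʳ w≈xay) (assoc _ y t))

  -- e ∙ (y ∙ q) is an idempotent below e, so primitivity forces it to be e.
  primitive-absorbs : ∀ {e q y} → IsPrimitiveIdempotent S e →
                      e ∙ q ≈ q → q ∙ e ≈ q → q ∙ y ≈ e → e ∙ (y ∙ q) ≈ e
  primitive-absorbs {e} {q} {y} (ee≈e , e-primitive) eq≈q qe≈q qy≈e =
    e-primitive (e ∙ (y ∙ q)) idempotent (below-right , below-left)
    where
    idempotent : (e ∙ (y ∙ q)) ∙ (e ∙ (y ∙ q)) ≈ e ∙ (y ∙ q)
    idempotent = begin
      (e ∙ (y ∙ q)) ∙ (e ∙ (y ∙ q))  ≈⟨ assoc e _ _ ⟩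
      e ∙ ((y ∙ q) ∙ (e ∙ (y ∙ q)))  ≈⟨ ∙-congˡ (assoc y q _) ⟩
      e ∙ (y ∙ (q ∙ (e ∙ (y ∙ q))))  ≈⟨ ∙-congˡ (∙-congˡ (x∙yz≈xy∙z q e _)) ⟩
      e ∙ (y ∙ ((q ∙ e) ∙ (y ∙ q)))  ≈⟨ ∙-congˡ (∙-congˡ (∙-congʳ qe≈q)) ⟩
      e ∙ (y ∙ (q ∙ (y ∙ q)))        ≈⟨ ∙-congˡ (∙-congˡ (x∙yz≈xy∙z q y q)) ⟩
      e ∙ (y ∙ ((q ∙ y) ∙ q))        ≈⟨ ∙-congˡ (∙-congˡ (∙-congʳ qy≈e)) ⟩
      e ∙ (y ∙ (e ∙ q))              ≈⟨ ∙-congˡ (∙-congˡ eq≈q) ⟩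
      e ∙ (y ∙ q)                    ∎
    below-right : (e ∙ (y ∙ q)) ∙ e ≈ e ∙ (y ∙ q)
    below-right = trans (assoc e _ e) (∙-congˡ (trans (assoc y q e) (∙-congˡ qe≈q)))
    below-left : e ∙ (e ∙ (y ∙ q)) ≈ e ∙ (y ∙ q)
    below-left = trans (x∙yz≈xy∙z e e _) (∙-congʳ ee≈e)

  -- For a ∈ J ⊆ S e, simplicity gives e = x a y; then q = e x a satisfies the hypotheses
  -- of primitive-absorbs, so e = e y e x a ∈ J.
  primitive⇒S·-minimal : ∀ {e} → IsSimple S → IsPrimitiveIdempotent S e → IsMinimalLeftIdeal S (S· e)
  primitive⇒S·-minimal {e} simple e-primitive@(ee≈e , _) = S·-isLeftIdeal e , minimal
    where
    minimal : ∀ J → IsLeftIdeal S J → J ⊆ S· e → S· e ⊆ J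
    minimal J (J-resp , (a , a∈J) , J-left) J⊆Se (s , w≈se) = J-resp (sym w≈se) (J-left s e∈J)
      where
      e∈SaS : e ∈ S· a ·S
      e∈SaS = simple (S· a ·S) (S·a·S-isIdeal a) e
      x = proj₁ e∈SaS
      y = proj₁ (proj₂ e∈SaS)
      q = e ∙ (x ∙ a)
      eq≈q : e ∙ q ≈ q
      eq≈q = trans (x∙yz≈xy∙z e e _) (∙-congʳ ee≈e)
      qe≈q : q ∙ e ≈ q
      qe≈q = trans (assoc e _ e) (∙-congˡ (trans (assoc x a e) (∙-congˡ (∈S·⇒∙-absorbs ee≈e (J⊆Se a∈J)))))
      qy≈e : q ∙ y ≈ e
      qy≈e = trans (assoc e _ y) (trans (∙-congˡ (sym (proj₂ (proj₂ e∈SaS)))) ee≈e)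
      e∈J : e ∈ J
      e∈J = J-resp (primitive-absorbs e-primitive eq≈q qe≈q qy≈e)
                   (J-left e (J-left y (J-left e (J-left x a∈J))))

module MinimalLeftIdealPartition {c ℓ} (S : Semigroup c ℓ) (simple : IsSimple S) {n : ℕ}
  (F : Bijection (setoid (Fin n)) (MinimalLeftIdeals S)) {A₀ : Subset S} (A₀-minimal : IsMinimalLeftIdeal S A₀) where
  open Semigroup S using (refl)
  open LeftIdeals S using (meet⇒⊆; ·-minimal)
  open Bijection F using (injective; surjective)

  L : Fin n → Subset S
  L i = proj₁ (Bijection.to F i)

  L-minimal : ∀ i → IsMinimalLeftIdeal S (L i)
  L-minimal i = proj₂ (Bijection.to F i)

  L-isLeftIdeal : ∀ i → IsLeftIdeal S (L i)
  L-isLeftIdeal i = proj₁ (L-minimal i)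

  L-nonEmpty : ∀ i → ∃ λ u → u ∈ L i
  L-nonEmpty i = proj₁ (proj₂ (L-isLeftIdeal i))

  index : ∀ {A} → IsMinimalLeftIdeal S A → Fin n
  index A-min = proj₁ (surjective (_ , A-min))

  ⊆L-index : ∀ {A} (A-min : IsMinimalLeftIdeal S A) → A ⊆ L (index A-min)
  ⊆L-index A-min = proj₂ (proj₂ (surjective (_ , A-min)) ≡.refl)

  meet⇒≡ : ∀ {i j z} → z ∈ L i → z ∈ L j → i ≡ j
  meet⇒≡ {i} {j} z∈Li z∈Lj = injective
    ( meet⇒⊆ (L-minimal i) (L-isLeftIdeal j) z∈Li z∈Lj
    , meet⇒⊆ (L-minimal j) (L-isLeftIdeal i) z∈Lj z∈Li )

  cover : ∀ z → ∃ λ i → z ∈ L i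
  cover = simple ⋃L ⋃L-isIdeal
    where
    ⋃L : Subset S
    ⋃L z = ∃ λ i → z ∈ L i
    ⋃L-isIdeal : IsIdeal S ⋃L
    ⋃L-isIdeal =
        (λ z≈z′ (i , z∈Li) → i , proj₁ (L-isLeftIdeal i) z≈z′ z∈Li)
      , (let (u , u∈A₀) = proj₁ (proj₂ (proj₁ A₀-minimal)) in u , index A₀-minimal , ⊆L-index A₀-minimal u∈A₀)
      , (λ s (i , z∈Li) → i , proj₂ (proj₂ (L-isLeftIdeal i)) s z∈Li)
      , (λ s {z} (i , z∈Li) → _ , ⊆L-index (·-minimal (L-minimal i) s) (z , z∈Li , refl))

  ⋃ : (Fin n → Fin 2) → Subset S
  ⋃ Q z = ∃ λ i → Q i ≡ 1F × z ∈ L i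

  ⋃-isLeftIdeal : ∀ {Q i} → Q i ≡ 1F → IsLeftIdeal S (⋃ Q)
  ⋃-isLeftIdeal {Q} {i} Qi≡1 =
      (λ z≈z′ (j , Qj≡1 , z∈Lj) → j , Qj≡1 , proj₁ (L-isLeftIdeal j) z≈z′ z∈Lj)
    , (let (u , u∈L) = L-nonEmpty i in u , i , Qi≡1 , u∈L)
    , (λ s (j , Qj≡1 , z∈Lj) → j , Qj≡1 , proj₂ (proj₂ (L-isLeftIdeal j)) s z∈Lj)

  L⊆⋃⇒≡1F : ∀ {Q i} → L i ⊆ ⋃ Q → Q i ≡ 1F
  L⊆⋃⇒≡1F {Q} {i} Li⊆⋃Q =
    let (u , u∈Li) = L-nonEmpty i
        (j , Qj≡1 , u∈Lj) = Li⊆⋃Q u∈Li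
    in ≡.subst (λ k → Q k ≡ 1F) (meet⇒≡ u∈Lj u∈Li) Qj≡1

  ⋃-notWhole : ∀ {Q j} → Q j ≡ 0F → NotWhole S (⋃ Q)
  ⋃-notWhole {Q} Qj≡0 ⋃Q-whole = contradiction (≡.trans (≡.sym Qj≡0) (L⊆⋃⇒≡1F (λ {z} _ → ⋃Q-whole z))) λ ()

  ⋃-cong : ∀ {Q Q′} → Q ≗ Q′ → ⋃ Q ⊆ ⋃ Q′
  ⋃-cong Q≗Q′ (i , Qi≡1 , z∈Li) = i , ≡.trans (≡.sym (Q≗Q′ i)) Qi≡1 , z∈Li

  ⋃-injective : ∀ {Q Q′} → ⋃ Q ⊆ ⋃ Q′ → ⋃ Q′ ⊆ ⋃ Q → Q ≗ Q′
  ⋃-injective ⋃Q⊆⋃Q′ ⋃Q′⊆⋃Q i = ≡1F⇔⇒≡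
    (λ Qi≡1 → L⊆⋃⇒≡1F (λ z∈Li → ⋃Q⊆⋃Q′ (i , Qi≡1 , z∈Li)))
    (λ Q′i≡1 → L⊆⋃⇒≡1F (λ z∈Li → ⋃Q′⊆⋃Q (i , Q′i≡1 , z∈Li)))

  module _ (lem : ExcludedMiddle (c ⊔ ℓ)) where

    χ : Subset S → Fin n → Fin 2
    χ I i = indicator (lem {L i ⊆ I})

    ⋃χ⊆ : ∀ I → ⋃ (χ I) ⊆ I
    ⋃χ⊆ I (i , χi≡1 , z∈Li) = indicator≡1F⇒ lem χi≡1 z∈Li

    ⊆⋃χ : ∀ {I} → IsLeftIdeal S I → I ⊆ ⋃ (χ I)
    ⊆⋃χ {I} I-left {z} z∈I =
      let (i , z∈Li) = cover z
      in i , ⇒indicator≡1F lem (meet⇒⊆ (L-minimal i) I-left z∈Li z∈I) , z∈Li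

    nonConstant↔InVertices : Bijection (Without₂ (Fin n →-setoid Fin 2) (λ _ → 0F) (λ _ → 1F)) (InVertices S)
    nonConstant↔InVertices = record
      { to        = λ (Q , Q≉0 , Q≉1) → ⋃ Q
                                       , ⋃-isLeftIdeal (proj₂ (¬const⇒∃ Q (λ ()) Q≉0))
                                       , ⋃-notWhole (proj₂ (¬const⇒∃ Q (λ ()) Q≉1))
      ; cong      = λ Q≗Q′ → ⋃-cong Q≗Q′ , ⋃-cong (≡.sym ∘ Q≗Q′)
      ; bijective = (λ (⋃Q⊆⋃Q′ , ⋃Q′⊆⋃Q) → ⋃-injective ⋃Q⊆⋃Q′ ⋃Q′⊆⋃Q)
                  , λ (I , I-left , I≠S) →
                      (χ I , χ≉0 I-left , χ≉1 I≠S)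
                    , λ Q≗χ → (⋃χ⊆ I ∘ ⋃-cong Q≗χ) , (⋃-cong (≡.sym ∘ Q≗χ) ∘ ⊆⋃χ I-left)
      }
      where
      χ≉0 : ∀ {I} → IsLeftIdeal S I → ¬ (∀ i → χ I i ≡ 0F)
      χ≉0 I-left@(_ , (u , u∈I) , _) χ≡0 =
        let (i , χi≡1 , _) = ⊆⋃χ I-left u∈I in contradiction (≡.trans (≡.sym (χ≡0 i)) χi≡1) λ ()
      χ≉1 : ∀ {I} → NotWhole S I → ¬ (∀ i → χ I i ≡ 1F)
      χ≉1 {I} I≠S χ≡1 = I≠S λ z → let (i , z∈Li) = cover z in ⋃χ⊆ I (i , χ≡1 i , z∈Li)

mainTheorem8 : ∀ {c ℓ} → ExcludedMiddle (c ⊔ ℓ) →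
    (S : Semigroup c ℓ) → IsCompletelySimple S → (n : ℕ) →
    Bijection (setoid (Fin n)) (MinimalLeftIdeals S) →
    Bijection (setoid (Fin (2 ^ n ∸ 2))) (InVertices S)
mainTheorem8 lem S (simple , e , e-primitive) n F =
  bijection-trans (Fin-without₂ const0≢const1)
    (bijection-trans (Inverse⇒Bijection (inverse-sym (without₂ (funToFin-inverse {n} {2}))))
      (nonConstant↔InVertices lem))
  where
  open LeftIdeals S using (S·_; primitive⇒S·-minimal)
  S·e-minimal : IsMinimalLeftIdeal S (S· e)
  S·e-minimal = primitive⇒S·-minimal simple e-primitive
  open MinimalLeftIdealPartition S simple F S·e-minimal
  const0≢const1 : funToFin {n} {2} (λ _ → 0F) ≢ funToFin {n} {2} (λ _ → 1F)
  const0≢const1 eq =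
    contradiction (Injection.injective (Inverse⇒Injection (funToFin-inverse {n} {2})) eq (index S·e-minimal)) λ ()
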